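{- Let $G$ be a finite simple connected graph, let $M_1,M_2,\dots,M_m$ be perfect matchings of $G$, and let $k$ be a positive integer such that each edge of $G$ belongs to at most $k$ of the matchings $M_1,\dots,M_m$. Then \[\mathrm{cf}(G)\ge \frac{1}{k}\sum_{i=1}^m f(M_i).\]
   Context: A perfect matching of $G$ is a set of pairwise disjoint edges covering every vertex. For a perfect matching $M$, a subset $S\subseteq M$ is a forcing set of $M$ if $M$ is the unique perfect matching of $G$ containing $S$; $f(M)$ is the minimum size of a forcing set of $M$. A subset $S\subseteq E(G)$ is a complete forcing set of $G$ if for every perfect matching $M$ of $G$, $S\cap M$ is a forcing set of $M$; $\mathrm{cf}(G)$ is the minimum size of a complete forcing set. -}

module Defs where

open import Data.Nat using (ℕ; _≤_; _*_)
open import Data.Fin using (Fin)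
open import Data.Fin.Subset using (Subset; _∈_; _⊆_; _∩_; ∣_∣)
open import Data.Vec using (tabulate; lookup; sum)
open import Data.Product using (_×_; Σ; ∃; _,_; proj₁; proj₂)
open import Data.Sum using (_⊎_)
open import Relation.Nullary using (¬_)
open import Relation.Binary.PropositionalEquality using (_≡_)
open import Relation.Binary.Construct.Closure.ReflexiveTransitive using (Star)

record Graph : Set where
  field
    n    : ℕ
    e    : ℕ
    ends : Fin e → Fin n × Fin n
    loopless : ∀ i → ¬ (proj₁ (ends i) ≡ proj₂ (ends i))
    noMulti  : ∀ i j →
      (ends i ≡ ends j ⊎ (proj₁ (ends i) ≡ proj₂ (ends j) × proj₂ (ends i) ≡ proj₁ (ends j)))
      → i ≡ j

module _ (G : Graph) where
  open Graph G

  Incident : Fin n → Fin e → Set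
  Incident v i = proj₁ (ends i) ≡ v ⊎ proj₂ (ends i) ≡ v

  Adj : Fin n → Fin n → Set
  Adj u v = ∃ λ i → (proj₁ (ends i) ≡ u × proj₂ (ends i) ≡ v)
                  ⊎ (proj₁ (ends i) ≡ v × proj₂ (ends i) ≡ u)

  Connected : Set
  Connected = ∀ u v → Star Adj u v

  EdgeSet : Set
  EdgeSet = Subset e

  IsPerfectMatching : EdgeSet → Set
  IsPerfectMatching M =
    ∀ v → (∃ λ i → i ∈ M × Incident v i)
        × (∀ i j → i ∈ M → Incident v i → j ∈ M → Incident v j → i ≡ j)

  IsForcingSet : EdgeSet → EdgeSet → Set
  IsForcingSet M S = S ⊆ M × (∀ M' → IsPerfectMatching M' → S ⊆ M' → M' ≡ M)

  ForcingNumber : EdgeSet → ℕ → Set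
  ForcingNumber M d =
    (Σ EdgeSet λ S → IsForcingSet M S × ∣ S ∣ ≡ d)
    × (∀ S → IsForcingSet M S → d ≤ ∣ S ∣)

  IsCompleteForcingSet : EdgeSet → Set
  IsCompleteForcingSet S = ∀ M → IsPerfectMatching M → IsForcingSet M (S ∩ M)

  CompleteForcingNumber : ℕ → Set
  CompleteForcingNumber c =
    (Σ EdgeSet λ S → IsCompleteForcingSet S × ∣ S ∣ ≡ c)
    × (∀ S → IsCompleteForcingSet S → c ≤ ∣ S ∣)

  multiplicity : {m : ℕ} → (Fin m → EdgeSet) → Fin e → ℕ
  multiplicity Ms j = ∣ tabulate (λ i → lookup (Ms i) j) ∣

-- Double counting: a complete forcing set S meets each M i in a forcing set of M i,
-- so f (M i) ≤ ∣ S ∩ M i ∣, and summing over i counts every edge of S once for each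
-- matching containing it, which is at most k times.
module Submission where

open import Defs
open import Data.Bool using (Bool; true; false; _∧_)
open import Data.Nat using (ℕ; _≤_; _*_; NonZero; zero; suc; _+_)
open import Data.Nat.Properties using (+-*-semiring; ≤-refl; +-mono-≤; *-monoʳ-≤; *-comm; *-identityˡ; module ≤-Reasoning)
open import Data.Fin using (Fin)
open import Data.Fin.Subset using (Subset; _∩_; ∣_∣)
open import Data.Vec using (tabulate; sum; lookup; []; _∷_)
open import Data.Vec.Properties using (lookup-zipWith; lookup∘tabulate)
open import Data.Product using (_,_)
open import Function using (_∘_)
open import Relation.Binary.PropositionalEquality using (_≡_; refl; sym; trans; cong; module ≡-Reasoning)
open import Algebra.Properties.Semiring.Sum +-*-semiring using (sum-syntax; ∑-comm; sum-cong-≗; *-distribˡ-sum; *-distribʳ-sum) renaming (sum to ∑)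

private
  variable
    m n : ℕ

sum-tabulate : (f : Fin n → ℕ) → sum (tabulate f) ≡ ∑ f
sum-tabulate {zero}  f = refl
sum-tabulate {suc n} f = cong (f Fin.zero +_) (sum-tabulate (f ∘ Fin.suc))

∑-mono-≤ : {f g : Fin n → ℕ} → (∀ i → f i ≤ g i) → ∑ f ≤ ∑ g
∑-mono-≤ {zero}  f≤g = ≤-refl
∑-mono-≤ {suc n} f≤g = +-mono-≤ (f≤g Fin.zero) (∑-mono-≤ (f≤g ∘ Fin.suc))

toℕ : Bool → ℕ
toℕ true  = 1
toℕ false = 0

toℕ-∧ : ∀ a b → toℕ (a ∧ b) ≡ toℕ a * toℕ b
toℕ-∧ true  b = sym (*-identityˡ (toℕ b))
toℕ-∧ false b = refl

χ : Subset n → Fin n → ℕ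
χ p j = toℕ (lookup p j)

χ-∩ : (p q : Subset n) (j : Fin n) → χ (p ∩ q) j ≡ χ p j * χ q j
χ-∩ p q j = trans (cong toℕ (lookup-zipWith _∧_ j p q)) (toℕ-∧ (lookup p j) (lookup q j))

∣p∣≡∑χ : (p : Subset n) → ∣ p ∣ ≡ ∑ (χ p)
∣p∣≡∑χ []          = refl
∣p∣≡∑χ (true  ∷ p) = cong suc (∣p∣≡∑χ p)
∣p∣≡∑χ (false ∷ p) = ∣p∣≡∑χ p

∣p∩q∣≡∑χp*χq : (p q : Subset n) → ∣ p ∩ q ∣ ≡ ∑[ j < n ] (χ p j * χ q j)
∣p∩q∣≡∑χp*χq p q = trans (∣p∣≡∑χ (p ∩ q)) (sum-cong-≗ (χ-∩ p q))

occurrences : (Fin m → Subset n) → Fin n → ℕ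
occurrences qs j = ∣ tabulate (λ i → lookup (qs i) j) ∣

occurrences≡∑χ : (qs : Fin m → Subset n) (j : Fin n) → occurrences qs j ≡ ∑[ i < m ] χ (qs i) j
occurrences≡∑χ qs j =
  trans (∣p∣≡∑χ (tabulate column)) (sum-cong-≗ (cong toℕ ∘ lookup∘tabulate column))
  where column = λ i → lookup (qs i) j

∑∣p∩qᵢ∣≡∑χp*occurrences : (p : Subset n) (qs : Fin m → Subset n) →
  ∑[ i < m ] ∣ p ∩ qs i ∣ ≡ ∑[ j < n ] (χ p j * occurrences qs j)
∑∣p∩qᵢ∣≡∑χp*occurrences p qs = begin
  ∑[ i < _ ] ∣ p ∩ qs i ∣                    ≡⟨ sum-cong-≗ (∣p∩q∣≡∑χp*χq p ∘ qs) ⟩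
  ∑[ i < _ ] ∑[ j < _ ] (χ p j * χ (qs i) j) ≡⟨ ∑-comm (λ i j → χ p j * χ (qs i) j) ⟩
  ∑[ j < _ ] ∑[ i < _ ] (χ p j * χ (qs i) j) ≡⟨ sum-cong-≗ (λ j → sym (*-distribˡ-sum (χ p j) (λ i → χ (qs i) j))) ⟩
  ∑[ j < _ ] (χ p j * ∑[ i < _ ] χ (qs i) j) ≡⟨ sum-cong-≗ (λ j → cong (χ p j *_) (sym (occurrences≡∑χ qs j))) ⟩
  ∑[ j < _ ] (χ p j * occurrences qs j)      ∎
  where open ≡-Reasoning

∑∣p∩qᵢ∣≤k*∣p∣ : (p : Subset n) (qs : Fin m → Subset n) (k : ℕ) →
  (∀ j → occurrences qs j ≤ k) → ∑[ i < m ] ∣ p ∩ qs i ∣ ≤ k * ∣ p ∣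
∑∣p∩qᵢ∣≤k*∣p∣ p qs k occurrences≤k = begin
  ∑[ i < _ ] ∣ p ∩ qs i ∣               ≡⟨ ∑∣p∩qᵢ∣≡∑χp*occurrences p qs ⟩
  ∑[ j < _ ] (χ p j * occurrences qs j) ≤⟨ ∑-mono-≤ (λ j → *-monoʳ-≤ (χ p j) (occurrences≤k j)) ⟩
  ∑[ j < _ ] (χ p j * k)                ≡⟨ *-distribʳ-sum k (χ p) ⟨
  ∑ (χ p) * k                           ≡⟨ cong (_* k) (∣p∣≡∑χ p) ⟨
  ∣ p ∣ * k                             ≡⟨ *-comm ∣ p ∣ k ⟩
  k * ∣ p ∣                             ∎
  where open ≤-Reasoning

forcingNumber≤∣S∩M∣ : (G : Graph) {S M : EdgeSet G} {d : ℕ} →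
  IsCompleteForcingSet G S → IsPerfectMatching G M → ForcingNumber G M d → d ≤ ∣ S ∩ M ∣
forcingNumber≤∣S∩M∣ G {S} {M} complete perfect (_ , minimal) = minimal (S ∩ M) (complete M perfect)

lemma5 : (G : Graph) → Connected G →
         (m : ℕ) (Ms : Fin m → EdgeSet G) → (∀ i → IsPerfectMatching G (Ms i)) →
         (k : ℕ) → .{{_ : NonZero k}} →
         (∀ j → multiplicity G Ms j ≤ k) →
         (fs : Fin m → ℕ) → (∀ i → ForcingNumber G (Ms i) (fs i)) →
         (c : ℕ) → CompleteForcingNumber G c →
         sum (tabulate fs) ≤ k * c
lemma5 G _ m Ms perfect k multiplicity≤k fs forcing c ((S , complete , ∣S∣≡c) , _) = begin
  sum (tabulate fs)       ≡⟨ sum-tabulate fs ⟩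
  ∑[ i < m ] fs i         ≤⟨ ∑-mono-≤ (λ i → forcingNumber≤∣S∩M∣ G complete (perfect i) (forcing i)) ⟩
  ∑[ i < m ] ∣ S ∩ Ms i ∣ ≤⟨ ∑∣p∩qᵢ∣≤k*∣p∣ S Ms k multiplicity≤k ⟩
  k * ∣ S ∣               ≡⟨ cong (k *_) ∣S∣≡c ⟩
  k * c                   ∎
  where open ≤-Reasoning
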